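{- Let $p\ge 1$ and let $\pi,\tau$ be endhered patterns of size $p$ such that $\pi=\operatorname{letw}(\tau)$ or $\pi=\operatorname{retw}(\tau)$; that is, $\pi$ is the complement $(p+1-\tau_1)\ldots(p+1-\tau_p)$ of $\tau$, or $\pi$ is the reverse $\tau_p\ldots\tau_1$ of $\tau$. Then for all integers $n,k,m\ge 0$, $$a_{n,k,m}(\pi,\tau)=a_{n,k,m}(\tau,\pi).$$ In particular, $a_{n,k}(\pi)=a_{n,k}(\tau)$ for all $n,k$.
   Context: A (perfect) matching of size $n$ is a partition of $\{1,\dots,2n\}$ into $n$ two-element sets called arcs; for an arc $\{a,b\}$ with $a<b$, $a$ is its starting point and $b$ its ending point. An endhered pattern of size $p$ is identified with a permutation $\pi=\pi_1\ldots\pi_p$ of $\{1,\dots,p\}$; it corresponds to the matching of size $p$ whose arcs are $\{\pi_t,\,p+t\}$, $t=1,\dots,p$. A matching $\mu$ of size $n$ contains an occurrence of $\pi$ at position $(i+1,j+1)$, where $i,j$ are integers with $i\ge 0$, $i+p\le j$ and $j+p\le 2n$, if $\{i+\pi_t,\ j+t\}$ is an arc of $\mu$ for every $t=1,\dots,p$ (so the $p$ arcs have consecutive starting points $i+1,\dots,i+p$ and consecutive ending points $j+1,\dots,j+p$). The number of occurrences of $\pi$ in $\mu$ is the number of pairs $(i,j)$ for which this holds. $a_{n,k}(\pi)$ denotes the number of matchings of size $n$ with exactly $k$ occurrences of $\pi$, and $a_{n,k,m}(\pi,\tau)$ the number of matchings of size $n$ with exactly $k$ occurrences of $\pi$ and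 exactly $m$ occurrences of $\tau$. The left (resp. right) endhered twist of a matching $\mu$ is obtained by reversing every maximal run of consecutive positions that are all starting (resp. all ending) points: if $\phi$ is the bijection of $\{1,\dots,2n\}$ sending $x$ to $r+s-x$ when $x$ lies in such a maximal run $\{r,\dots,s\}$ and fixing all other points, the twisted matching has arcs $\{\phi(a),\phi(b)\}$ for the arcs $\{a,b\}$ of $\mu$. On endhered patterns (viewed as permutations) the left twist $\operatorname{letw}$ is the complement and the right twist $\operatorname{retw}$ is the reverse. -}

module Defs where

open import Data.Nat using (ℕ; zero; suc; _+_; _*_; _<?_; _≤ᵇ_; _≡ᵇ_)
open import Data.Bool using (Bool; true; false; _∧_; not)
open import Data.Fin using (Fin; toℕ; fromℕ<)
open import Data.Vec using (Vec; []; _∷_; lookup)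
open import Data.List using (List; []; _∷_; [_]; map; concatMap; allFin; upTo; length; filterᵇ)
open import Relation.Nullary using (yes; no)
open import Data.Product using (_×_; _,_; proj₁; proj₂)

andL : List Bool → Bool
andL []       = true
andL (b ∷ bs) = b ∧ andL bs

countᵇ : {A : Set} → (A → Bool) → List A → ℕ
countᵇ P xs = length (filterᵇ P xs)

allVecs : (m n : ℕ) → List (Vec (Fin m) n)
allVecs m zero    = [ [] ]
allVecs m (suc n) = concatMap (λ x → map (x ∷_) (allVecs m n)) (allFin m)

-- A matching of size n on the points 1,…,2n is encoded 0-indexed (the
-- paper's point x+1 is position x here) by its partner table
-- v : Vec (Fin (2n)) (2n): v[x] is the other endpoint of the arc through x.
-- A table encodes a perfect matching iff it is a fixed-point-free involution;
-- this is a bijection between matchings and such tables.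
isMatchingᵇ : {N : ℕ} → Vec (Fin N) N → Bool
isMatchingᵇ {N} v =
  andL (map (λ x → not (toℕ (lookup v x) ≡ᵇ toℕ x)
                   ∧ (toℕ (lookup v (lookup v x)) ≡ᵇ toℕ x))
            (allFin N))

isArcᵇ : {N : ℕ} → Vec (Fin N) N → ℕ → ℕ → Bool
isArcᵇ {N} v a b with a <? N
... | yes a<N = toℕ (lookup v (fromℕ< a<N)) ≡ᵇ b
... | no _    = false

-- An endhered pattern of size p is a permutation of {1,…,p}, encoded
-- 0-indexed as π : Fin p → Fin p (π t = π_{t+1} - 1).
-- Occurrence of π in v at offsets (i , j) (the paper's position (i+1, j+1)):
-- i + p ≤ j, j + p ≤ 2n and {i + π_t , j + t} is an arc for t = 1,…,p,
-- i.e. 0-indexed {i + toℕ (π t) , j + toℕ t} for t : Fin p.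
occursAtᵇ : {p N : ℕ} → (Fin p → Fin p) → Vec (Fin N) N → ℕ → ℕ → Bool
occursAtᵇ {p} {N} π v i j =
  (i + p ≤ᵇ j) ∧ (j + p ≤ᵇ N)
  ∧ andL (map (λ t → isArcᵇ v (i + toℕ (π t)) (j + toℕ t)) (allFin p))

-- Number of occurrences: number of pairs (i , j) with 0 ≤ i, j ≤ N.
-- (Any occurrence has i , j ≤ N, so this range is exhaustive.)
occurrences : {p N : ℕ} → (Fin p → Fin p) → Vec (Fin N) N → ℕ
occurrences {p} {N} π v =
  countᵇ (λ ij → occursAtᵇ π v (proj₁ ij) (proj₂ ij))
         (concatMap (λ i → map (λ j → (i , j)) (upTo (suc N))) (upTo (suc N)))

a₂ : {p : ℕ} → (Fin p → Fin p) → ℕ → ℕ → ℕ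
a₂ π n k =
  countᵇ (λ v → isMatchingᵇ v ∧ (occurrences π v ≡ᵇ k)) (allVecs (2 * n) (2 * n))

a₃ : {p : ℕ} → (Fin p → Fin p) → (Fin p → Fin p) → ℕ → ℕ → ℕ → ℕ
a₃ π τ n k m =
  countᵇ (λ v → isMatchingᵇ v ∧ (occurrences π v ≡ᵇ k) ∧ (occurrences τ v ≡ᵇ m))
         (allVecs (2 * n) (2 * n))

-- The left twist is an involution on matchings that preserves the set of starting points. The p
-- starting points i, …, i+p-1 of an occurrence of π at (i, j) form an interval inside one run of
-- starting points, and reversing that run reverses the interval: the twisted matching has an
-- occurrence of letw π ending at the same points j, …, j+p-1, and this matches the occurrences of
-- π in μ bijectively with those of letw π in the twisted matching. Hence the twist sends matchings
-- with k occurrences of π and m of τ = letw π to matchings with k occurrences of τ and m of π, and,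
-- being an involution, it is a bijection between the two sets. The case π = retw τ is the same
-- argument for the right twist and runs of ending points.

module Submission where

open import Defs
open import Data.Bool using (Bool; true; false; T; _∧_; not)
open import Data.Bool.Properties using (T-∧; T-≡; T-not-≡; ¬-not)
open import Data.Empty using (⊥; ⊥-elim)
open import Data.Fin using (Fin; toℕ; fromℕ<; fromℕ; opposite; punchOut)
import Data.Fin as Fin
open import Data.Fin.Properties
  using (toℕ<n; toℕ-fromℕ; toℕ-fromℕ<; fromℕ<-toℕ; toℕ-injective; opposite-prop; opposite-involutive;
         any?; punchOut-injective; injective⇒≤)
  renaming (_≟_ to _≟ᶠ_)
open import Data.List
  using (List; []; _∷_; _++_; map; length; filterᵇ; concatMap; cartesianProductWith; cartesianProduct;
         allFin; upTo)
open import Data.List.Properties using (length-map; map-id-local; map-∘)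
open import Data.List.Membership.Propositional using (_∈_)
open import Data.List.Membership.Propositional.Properties
  using (∈-filter⁺; ∈-filter⁻; ∈-map⁺; ∈-map⁻; ∈-cartesianProductWith⁺; ∈-cartesianProduct⁺;
         ∈-allFin; ∈-upTo⁺)
open import Data.List.Membership.Propositional.Properties.WithK using (unique∧set⇒bag)
open import Data.List.Relation.Binary.BagAndSetEquality using (∼bag⇒↭)
open import Data.List.Relation.Binary.Permutation.Propositional.Properties using (↭-length)
open import Data.List.Relation.Unary.All using ([])
import Data.List.Relation.Unary.All as All
open import Data.List.Relation.Unary.All.Properties using (all-filter)
open import Data.List.Relation.Unary.AllPairs using ([]; _∷_)
import Data.List.Relation.Unary.AllPairs as AllPairs
open import Data.List.Relation.Unary.AllPairs.Properties using (map⁻)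
open import Data.List.Relation.Unary.Any using (here; there)
open import Data.List.Relation.Unary.Unique.Propositional using (Unique)
open import Data.List.Relation.Unary.Unique.Propositional.Properties
  using (filter⁺; cartesianProductWith⁺; cartesianProduct⁺; allFin⁺; upTo⁺)
open import Data.Nat using (ℕ; zero; suc; _+_; _*_; _∸_; _<_; _≤_; _<?_; _<ᵇ_; _≤ᵇ_; _≡ᵇ_; z≤n; s≤s; z<s)
open import Data.Nat.Properties
open import Algebra.Properties.CommutativeSemigroup +-commutativeSemigroup using (x∙yz≈y∙xz)
open import Data.Product using (_×_; _,_; proj₁; proj₂; ∃; uncurry)
open import Data.Sum using (_⊎_; inj₁; inj₂)
open import Data.Vec using (Vec; []; _∷_; lookup; tabulate)
open import Data.Vec.Properties
  using (∷-injectiveˡ; ∷-injectiveʳ; lookup∘tabulate; tabulate∘lookup; tabulate-cong)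
open import Function.Base using (_∘_; _∘′_)
open import Function.Bundles using (Equivalence; mk⇔)
open import Function.Definitions using (Injective)
open import Relation.Binary.Definitions using (tri<; tri≈; tri>)
open import Relation.Binary.PropositionalEquality
open import Relation.Nullary using (¬_; yes; no; Dec)
open import Relation.Nullary.Decidable using (T?)

open Equivalence using (to; from)

private variable A B : Set

Unique-map-leftInverse : (f : A → B) (g : B → A) {xs : List A}
  → map g (map f xs) ≡ xs → Unique xs → Unique (map f xs)
Unique-map-leftInverse f g gf≡id u =
  AllPairs.map (λ gx≢gy fx≡fy → gx≢gy (cong g fx≡fy)) (map⁻ (subst Unique (sym gf≡id) u))

countᵇ-involution : (P Q : A → Bool) (f : A → A) {xs : List A} → Unique xs
  → (∀ {x} → T (P x) → x ∈ xs) → (∀ {x} → T (Q x) → x ∈ xs)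
  → (∀ {x} → T (P x) → T (Q (f x))) → (∀ {x} → T (Q x) → T (P (f x)))
  → (∀ {x} → T (P x) → f (f x) ≡ x) → (∀ {x} → T (Q x) → f (f x) ≡ x)
  → countᵇ P xs ≡ countᵇ Q xs
countᵇ-involution P Q f {xs} u P⊆xs Q⊆xs PQ QP invP invQ = begin
  length ps          ≡⟨ length-map f ps ⟨
  length (map f ps)  ≡⟨ ↭-length (∼bag⇒↭ (unique∧set⇒bag (Unique-map-leftInverse f f ff≡id (filter⁺ _ u))
                                                         (filter⁺ _ u) (mk⇔ image⊆qs qs⊆image))) ⟩
  length qs          ∎
  where
  open ≡-Reasoning
  ps = filterᵇ P xs
  qs = filterᵇ Q xs
  ff≡id : map f (map f ps) ≡ ps
  ff≡id = trans (sym (map-∘ ps)) (map-id-local (All.map invP (all-filter (T? ∘ P) xs)))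
  image⊆qs : ∀ {y} → y ∈ map f ps → y ∈ qs
  image⊆qs y∈ with x , x∈ , refl ← ∈-map⁻ f y∈ =
    let _ , Px = ∈-filter⁻ (T? ∘ P) {xs = xs} x∈ in ∈-filter⁺ (T? ∘ Q) (Q⊆xs (PQ Px)) (PQ Px)
  qs⊆image : ∀ {y} → y ∈ qs → y ∈ map f ps
  qs⊆image y∈ with _ , Qy ← ∈-filter⁻ (T? ∘ Q) {xs = xs} y∈ =
    subst (_∈ map f ps) (invQ Qy) (∈-map⁺ f (∈-filter⁺ (T? ∘ P) (P⊆xs (QP Qy)) (QP Qy)))

concatMap-map≡cartesianProductWith : {C : Set} (f : A → B → C) (xs : List A) (ys : List B)
  → concatMap (λ x → map (f x) ys) xs ≡ cartesianProductWith f xs ys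
concatMap-map≡cartesianProductWith f []       ys = refl
concatMap-map≡cartesianProductWith f (x ∷ xs) ys =
  cong (map (f x) ys ++_) (concatMap-map≡cartesianProductWith f xs ys)

allVecs-suc : ∀ m n → allVecs m (suc n) ≡ cartesianProductWith _∷_ (allFin m) (allVecs m n)
allVecs-suc m n = concatMap-map≡cartesianProductWith _∷_ (allFin m) (allVecs m n)

allVecs-Unique : ∀ m n → Unique (allVecs m n)
allVecs-Unique m zero    = [] ∷ []
allVecs-Unique m (suc n) = subst Unique (sym (allVecs-suc m n))
  (cartesianProductWith⁺ _∷_ (λ eq → ∷-injectiveˡ eq , ∷-injectiveʳ eq) (allFin⁺ m) (allVecs-Unique m n))

∈-allVecs : ∀ {m n} (v : Vec (Fin m) n) → v ∈ allVecs m n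
∈-allVecs []      = here refl
∈-allVecs {m} {suc n} (x ∷ v) =
  subst (x ∷ v ∈_) (sym (allVecs-suc m n)) (∈-cartesianProductWith⁺ _∷_ (∈-allFin x) (∈-allVecs v))

grid : ℕ → List (ℕ × ℕ)
grid N = concatMap (λ i → map (λ j → (i , j)) (upTo (suc N))) (upTo (suc N))

grid≡cartesianProduct : ∀ N → grid N ≡ cartesianProduct (upTo (suc N)) (upTo (suc N))
grid≡cartesianProduct N = concatMap-map≡cartesianProductWith _,_ (upTo (suc N)) (upTo (suc N))

grid-Unique : ∀ N → Unique (grid N)
grid-Unique N =
  subst Unique (sym (grid≡cartesianProduct N)) (cartesianProduct⁺ (upTo⁺ (suc N)) (upTo⁺ (suc N)))

∈-grid : ∀ {N i j} → i ≤ N → j ≤ N → (i , j) ∈ grid N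
∈-grid {N} {i} {j} i≤N j≤N =
  subst ((i , j) ∈_) (sym (grid≡cartesianProduct N))
    (∈-cartesianProduct⁺ (∈-upTo⁺ (s≤s i≤N)) (∈-upTo⁺ (s≤s j≤N)))

contradictionᵇ : ∀ {b} → b ≡ true → b ≡ false → ⊥
contradictionᵇ refl ()

<ᵇ-true⁻ : ∀ {m n} → (m <ᵇ n) ≡ true → m < n
<ᵇ-true⁻ {m} {n} e = <ᵇ⇒< m n (from T-≡ e)

<ᵇ-true⁺ : ∀ {m n} → m < n → (m <ᵇ n) ≡ true
<ᵇ-true⁺ m<n = to T-≡ (<⇒<ᵇ m<n)

<ᵇ-false⁻ : ∀ {m n} → (m <ᵇ n) ≡ false → ¬ m < n
<ᵇ-false⁻ e m<n = contradictionᵇ (<ᵇ-true⁺ m<n) e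

<ᵇ-false⁺ : ∀ {m n} → ¬ m < n → (m <ᵇ n) ≡ false
<ᵇ-false⁺ m≮n = ¬-not λ e → m≮n (<ᵇ-true⁻ e)

-- For x ∈ S, runStart S x and runEnd S N x are the first and last points of the maximal run of S
-- containing x (N is fuel for the search, enough when S ⊆ [0, N)), and reverseRuns S N is the
-- paper's φ: it reverses every maximal run of S and fixes all other points.
runStart : (ℕ → Bool) → ℕ → ℕ
runStart S zero    = zero
runStart S (suc x) with S x
... | true  = runStart S x
... | false = suc x

runEnd : (ℕ → Bool) → ℕ → ℕ → ℕ
runEnd S zero    x = x
runEnd S (suc f) x with S (suc x)
... | true  = runEnd S f (suc x)
... | false = x

reverseRuns : (ℕ → Bool) → ℕ → ℕ → ℕ
reverseRuns S N x with S x
... | true  = runStart S x + runEnd S N x ∸ x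
... | false = x

module _ {S S′ : ℕ → Bool} (S≗S′ : ∀ x → S x ≡ S′ x) where

  runStart-cong : ∀ x → runStart S x ≡ runStart S′ x
  runStart-cong zero = refl
  runStart-cong (suc x) rewrite S≗S′ x with S′ x
  ... | true  = runStart-cong x
  ... | false = refl

  runEnd-cong : ∀ f x → runEnd S f x ≡ runEnd S′ f x
  runEnd-cong zero    x = refl
  runEnd-cong (suc f) x rewrite S≗S′ (suc x) with S′ (suc x)
  ... | true  = runEnd-cong f (suc x)
  ... | false = refl

  reverseRuns-cong : ∀ N x → reverseRuns S N x ≡ reverseRuns S′ N x
  reverseRuns-cong N x rewrite S≗S′ x with S′ x
  ... | true  = cong₂ (λ a b → a + b ∸ x) (runStart-cong x) (runEnd-cong N x)
  ... | false = refl

module _ (S : ℕ → Bool) where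

  runStart-≤ : ∀ x → runStart S x ≤ x
  runStart-≤ zero = z≤n
  runStart-≤ (suc x) with S x
  ... | true  = m≤n⇒m≤1+n (runStart-≤ x)
  ... | false = ≤-refl

  runStart-run : ∀ x z → runStart S x ≤ z → z < x → S z ≡ true
  runStart-run (suc x) z lo≤z z<1+x with S x in Sx
  ... | false = ⊥-elim (<⇒≱ z<1+x lo≤z)
  ... | true with m≤n⇒m<n∨m≡n (≤-pred z<1+x)
  ...   | inj₁ z<x  = runStart-run x z lo≤z z<x
  ...   | inj₂ refl = Sx

  runStart-pred : ∀ x b → suc b ≡ runStart S x → S b ≡ false
  runStart-pred (suc x) b eq with S x in Sx
  ... | true  = runStart-pred x b eq
  ... | false with refl ← eq = Sx

  runStart-least : ∀ x z → z ≤ x → (∀ y → z ≤ y → y < x → S y ≡ true) → runStart S x ≤ z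
  runStart-least zero    z _   _   = z≤n
  runStart-least (suc x) z z≤1+x run with m≤n⇒m<n∨m≡n z≤1+x
  ... | inj₂ refl = runStart-≤ (suc x)
  ... | inj₁ z<1+x with S x in Sx
  ...   | true  = runStart-least x z (≤-pred z<1+x) (λ y z≤y y<x → run y z≤y (m≤n⇒m≤1+n y<x))
  ...   | false = ⊥-elim (contradictionᵇ (run x (≤-pred z<1+x) ≤-refl) Sx)

  runStart-unique : ∀ a y → a ≤ y → (∀ z → a ≤ z → z < y → S z ≡ true)
    → (∀ b → suc b ≡ a → S b ≡ false) → runStart S y ≡ a
  runStart-unique zero    y _   run _    = n≤0⇒n≡0 (runStart-least y 0 z≤n run)
  runStart-unique (suc b) y a≤y run pred = ≤-antisym (runStart-least y (suc b) a≤y run) (≮⇒≥ λ lo<1+b →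
    contradictionᵇ (runStart-run y b (≤-pred lo<1+b) a≤y) (pred b refl))

  runEnd-≥ : ∀ f x → x ≤ runEnd S f x
  runEnd-≥ zero    x = ≤-refl
  runEnd-≥ (suc f) x with S (suc x)
  ... | true  = ≤-trans (n≤1+n x) (runEnd-≥ f (suc x))
  ... | false = ≤-refl

  runEnd-run : ∀ f x z → x < z → z ≤ runEnd S f x → S z ≡ true
  runEnd-run zero    x z x<z z≤x = ⊥-elim (<⇒≱ x<z z≤x)
  runEnd-run (suc f) x z x<z z≤hi with S (suc x) in Sx
  ... | false = ⊥-elim (<⇒≱ x<z z≤hi)
  ... | true with m≤n⇒m<n∨m≡n x<z
  ...   | inj₁ 1+x<z = runEnd-run f (suc x) z 1+x<z z≤hi
  ...   | inj₂ refl  = Sx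

module RunReversal (S : ℕ → Bool) (N : ℕ) (S⊆N : ∀ x → S x ≡ true → x < N) where

  start end φ : ℕ → ℕ
  start = runStart S
  end   = runEnd S N
  φ     = reverseRuns S N

  end-≥ : ∀ x → x ≤ end x
  end-≥ = runEnd-≥ S N

  end-last : ∀ x → S (suc (end x)) ≡ false
  end-last x = go N x (m≤n+m N x)
    where
    go : ∀ f x → N ≤ x + f → S (suc (runEnd S f x)) ≡ false
    go zero x N≤x with S (suc x) in Sx
    ... | false = refl
    ... | true  = ⊥-elim (<⇒≱ (S⊆N (suc x) Sx) (m≤n⇒m≤1+n (subst (N ≤_) (+-identityʳ x) N≤x)))
    go (suc f) x N≤x+f with S (suc x) in Sx
    ... | true  = go f (suc x) (≤-trans N≤x+f (≤-reflexive (+-suc x f)))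
    ... | false = Sx

  end-unique : ∀ y b → y ≤ b → (∀ z → y < z → z ≤ b → S z ≡ true) → S (suc b) ≡ false → end y ≡ b
  end-unique y b y≤b run last with <-cmp (end y) b
  ... | tri≈ _ eq _   = eq
  ... | tri< e<b _ _  = ⊥-elim (contradictionᵇ (run (suc (end y)) (s≤s (end-≥ y)) e<b) (end-last y))
  ... | tri> _ _ b<e  = ⊥-elim (contradictionᵇ (runEnd-run S N y (suc b) (s≤s y≤b) b<e) last)

  inRun : ∀ x z → S x ≡ true → start x ≤ z → z ≤ end x → S z ≡ true
  inRun x z Sx s≤z z≤e with <-cmp z x
  ... | tri< z<x _ _  = runStart-run S x z s≤z z<x
  ... | tri≈ _ refl _ = Sx
  ... | tri> _ _ x<z  = runEnd-run S N x z x<z z≤e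

  sameRun : ∀ x y → S x ≡ true → start x ≤ y → y ≤ end x → start y ≡ start x × end y ≡ end x
  sameRun x y Sx s≤y y≤e =
    runStart-unique S (start x) y s≤y (λ z s≤z z<y → inRun x z Sx s≤z (≤-trans (<⇒≤ z<y) y≤e))
                    (runStart-pred S x) ,
    end-unique y (end x) y≤e (λ z y<z z≤e → inRun x z Sx (≤-trans s≤y (<⇒≤ y<z)) z≤e) (end-last x)

  φ-inRun : ∀ x → S x ≡ true → φ x ≡ start x + end x ∸ x
  φ-inRun x Sx with S x
  φ-inRun x refl | true = refl

  φ-fixes : ∀ x → S x ≡ false → φ x ≡ x
  φ-fixes x Sx with S x
  φ-fixes x refl | false = refl

  x≤start+end : ∀ x → x ≤ start x + end x
  x≤start+end x = ≤-trans (end-≥ x) (m≤n+m (end x) (start x))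

  φ-+ : ∀ x → S x ≡ true → φ x + x ≡ start x + end x
  φ-+ x Sx rewrite φ-inRun x Sx = m∸n+n≡m (x≤start+end x)

  start-≤-φ : ∀ x → S x ≡ true → start x ≤ φ x
  start-≤-φ x Sx rewrite φ-inRun x Sx =
    ≤-trans (≤-reflexive (sym (m+n∸n≡m (start x) (end x)))) (∸-monoʳ-≤ (start x + end x) (end-≥ x))

  φ-≤-end : ∀ x → S x ≡ true → φ x ≤ end x
  φ-≤-end x Sx rewrite φ-inRun x Sx =
    ≤-trans (∸-monoʳ-≤ (start x + end x) (runStart-≤ S x)) (≤-reflexive (m+n∸m≡n (start x) (end x)))

  φ-preserves : ∀ x → S x ≡ true → S (φ x) ≡ true
  φ-preserves x Sx = inRun x (φ x) Sx (start-≤-φ x Sx) (φ-≤-end x Sx)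

  φ-involutive : ∀ x → φ (φ x) ≡ x
  φ-involutive x = byCases (S x) refl
    where
    byCases : ∀ b → S x ≡ b → φ (φ x) ≡ x
    byCases false Sx = trans (cong φ (φ-fixes x Sx)) (φ-fixes x Sx)
    byCases true  Sx with start≡ , end≡ ← sameRun x (φ x) Sx (start-≤-φ x Sx) (φ-≤-end x Sx) = begin
      φ (φ x)                                 ≡⟨ φ-inRun (φ x) (φ-preserves x Sx) ⟩
      start (φ x) + end (φ x) ∸ φ x           ≡⟨ cong₂ (λ s e → s + e ∸ φ x) start≡ end≡ ⟩
      start x + end x ∸ φ x                   ≡⟨ cong (start x + end x ∸_) (φ-inRun x Sx) ⟩
      start x + end x ∸ (start x + end x ∸ x) ≡⟨ m∸[m∸n]≡n (x≤start+end x) ⟩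
      x                                       ∎
      where open ≡-Reasoning

  -- φ reflects each run about its midpoint, so φ x + x = start x + end x is constant along a run.
  φ-+-interval : ∀ {a b x} → (∀ z → a ≤ z → z ≤ b → S z ≡ true)
    → a ≤ x → x ≤ b → φ x + x ≡ φ b + b
  φ-+-interval {a} {b} {x} S[a,b] a≤x x≤b = begin
    φ x + x             ≡⟨ φ-+ x (S[a,b] x a≤x x≤b) ⟩
    start x + end x     ≡⟨ cong₂ _+_ start≡ end≡ ⟩
    start b + end b     ≡⟨ φ-+ b Sb ⟨
    φ b + b             ∎
    where
    open ≡-Reasoning
    Sb = S[a,b] b (≤-trans a≤x x≤b) ≤-refl
    s≤x = runStart-least S b x x≤b (λ z x≤z z<b → S[a,b] z (≤-trans a≤x x≤z) (<⇒≤ z<b))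
    start≡ = proj₁ (sameRun b x Sb s≤x (≤-trans x≤b (end-≥ b)))
    end≡ = proj₂ (sameRun b x Sb s≤x (≤-trans x≤b (end-≥ b)))

  φ-<-gap : ∀ z y → S z ≡ true → S y ≡ false → z < y → φ z < y
  φ-<-gap z y Sz Sy z<y =
    ≤-<-trans (φ-≤-end z Sz) (≰⇒> λ y≤e → contradictionᵇ (runEnd-run S N z y z<y y≤e) Sy)

  gap-<-φ : ∀ z y → S z ≡ true → S y ≡ false → y < z → y < φ z
  gap-<-φ z y Sz Sy y<z =
    <-≤-trans (≰⇒> λ s≤y → contradictionᵇ (runStart-run S z y s≤y y<z) Sy) (start-≤-φ z Sz)

  φ-< : ∀ x → x < N → φ x < N
  φ-< x x<N = byCases (S x) refl
    where
    byCases : ∀ b → S x ≡ b → φ x < N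
    byCases false Sx = subst (_< N) (sym (φ-fixes x Sx)) x<N
    byCases true  Sx = S⊆N (φ x) (φ-preserves x Sx)

  φ-+-block : ∀ {a q} → (∀ k → k ≤ q → S (a + k) ≡ true)
    → ∀ k → k ≤ q → φ (a + k) + k ≡ φ (a + q) + q
  φ-+-block {a} {q} S-block k k≤q = +-cancelˡ-≡ a _ _ (begin
    a + (φ (a + k) + k)    ≡⟨ x∙yz≈y∙xz a (φ (a + k)) k ⟩
    φ (a + k) + (a + k)    ≡⟨ φ-+-interval S[a,a+q] (m≤m+n a k) (+-monoʳ-≤ a k≤q) ⟩
    φ (a + q) + (a + q)    ≡⟨ x∙yz≈y∙xz a (φ (a + q)) q ⟨
    a + (φ (a + q) + q)    ∎)
    where
    open ≡-Reasoning
    S[a,a+q] : ∀ z → a ≤ z → z ≤ a + q → S z ≡ true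
    S[a,a+q] z a≤z z≤a+q = subst (λ w → S w ≡ true) (m+[n∸m]≡n a≤z)
      (S-block (z ∸ a) (≤-trans (∸-monoˡ-≤ a z≤a+q) (≤-reflexive (m+n∸m≡n a q))))

T-andL⁻ : (f : A → Bool) (xs : List A) → T (andL (map f xs)) → ∀ {x} → x ∈ xs → T (f x)
T-andL⁻ f (y ∷ ys) h (here refl) = proj₁ (to T-∧ h)
T-andL⁻ f (y ∷ ys) h (there x∈) = T-andL⁻ f ys (proj₂ (to T-∧ h)) x∈

T-andL⁺ : (f : A → Bool) (xs : List A) → (∀ {x} → x ∈ xs → T (f x)) → T (andL (map f xs))
T-andL⁺ f []       h = _
T-andL⁺ f (y ∷ ys) h = from T-∧ (h (here refl) , T-andL⁺ f ys (h ∘′ there))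

module _ {N : ℕ} where

  partner : Vec (Fin N) N → ℕ → ℕ
  partner v x with x <? N
  ... | yes x<N = toℕ (lookup v (fromℕ< x<N))
  ... | no  _   = x

  partner-out : (v : Vec (Fin N) N) → ∀ x → ¬ x < N → partner v x ≡ x
  partner-out v x x≮N with x <? N
  ... | yes x<N = ⊥-elim (x≮N x<N)
  ... | no  _   = refl

  partner-lookup : (v : Vec (Fin N) N) (i : Fin N) → partner v (toℕ i) ≡ toℕ (lookup v i)
  partner-lookup v i with toℕ i <? N
  ... | yes i<N = cong (toℕ ∘ lookup v) (fromℕ<-toℕ i i<N)
  ... | no  i≮N = ⊥-elim (i≮N (toℕ<n i))

  partner-< : (v : Vec (Fin N) N) → ∀ x → x < N → partner v x < N
  partner-< v x x<N with x <? N
  ... | yes _   = toℕ<n _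
  ... | no  x≮N = ⊥-elim (x≮N x<N)

  T-isArcᵇ : (v : Vec (Fin N) N) → ∀ {a b} → T (isArcᵇ v a b) → a < N × partner v a ≡ b
  T-isArcᵇ v {a} {b} h with a <? N
  ... | yes a<N = a<N , ≡ᵇ⇒≡ _ b h

  isArcᵇ-T : (v : Vec (Fin N) N) → ∀ {a b} → a < N → partner v a ≡ b → T (isArcᵇ v a b)
  isArcᵇ-T v {a} {b} a<N eq with a <? N
  ... | yes _   = ≡⇒≡ᵇ _ b eq
  ... | no  a≮N = ⊥-elim (a≮N a<N)

  IsMatching : Vec (Fin N) N → Set
  IsMatching v = ∀ x → x < N → partner v x ≢ x × partner v (partner v x) ≡ x

  ∀<-fromFin : {P : ℕ → Set} → (∀ (i : Fin N) → P (toℕ i)) → ∀ x → x < N → P x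
  ∀<-fromFin {P} h x x<N = subst P (toℕ-fromℕ< x<N) (h (fromℕ< x<N))

  T-isMatchingᵇ : (v : Vec (Fin N) N) → T (isMatchingᵇ v) → IsMatching v
  T-isMatchingᵇ v h = ∀<-fromFin λ i →
    let notFixed , involutive = to T-∧ (T-andL⁻ _ (allFin N) h (∈-allFin i))
    in  (λ fixed → subst T (to T-not-≡ notFixed)
                     (≡⇒≡ᵇ _ _ (trans (sym (partner-lookup v i)) fixed))) ,
        (begin
          partner v (partner v (toℕ i))    ≡⟨ cong (partner v) (partner-lookup v i) ⟩
          partner v (toℕ (lookup v i))     ≡⟨ partner-lookup v (lookup v i) ⟩
          toℕ (lookup v (lookup v i))      ≡⟨ ≡ᵇ⇒≡ _ _ involutive ⟩
          toℕ i                            ∎)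
    where open ≡-Reasoning

  isMatchingᵇ-T : (v : Vec (Fin N) N) → IsMatching v → T (isMatchingᵇ v)
  isMatchingᵇ-T v m = T-andL⁺ _ (allFin N) λ {i} _ → from T-∧ (notFixed i , involutive i)
    where
    notFixed : ∀ i → T (not (toℕ (lookup v i) ≡ᵇ toℕ i))
    notFixed i with toℕ (lookup v i) ≡ᵇ toℕ i in eq
    ... | false = _
    ... | true  = proj₁ (m (toℕ i) (toℕ<n i))
                    (trans (partner-lookup v i) (≡ᵇ⇒≡ _ _ (subst T (sym eq) _)))
    involutive : ∀ i → T (toℕ (lookup v (lookup v i)) ≡ᵇ toℕ i)
    involutive i = ≡⇒≡ᵇ _ _ (trans (sym (partner-lookup v (lookup v i)))
      (trans (cong (partner v) (sym (partner-lookup v i))) (proj₂ (m (toℕ i) (toℕ<n i)))))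

  partner-injective : ∀ {u w : Vec (Fin N) N} → (∀ x → x < N → partner u x ≡ partner w x) → u ≡ w
  partner-injective {u} {w} h = begin
    u                    ≡⟨ tabulate∘lookup u ⟨
    tabulate (lookup u)  ≡⟨ tabulate-cong (λ i → toℕ-injective
                              (trans (sym (partner-lookup u i)) (trans (h (toℕ i) (toℕ<n i)) (partner-lookup w i)))) ⟩
    tabulate (lookup w)  ≡⟨ tabulate∘lookup w ⟩
    w                    ∎
    where open ≡-Reasoning

  private
    clamp : ℕ → Fin N → Fin N
    clamp y i with y <? N
    ... | yes y<N = fromℕ< y<N
    ... | no  _   = i

  -- Out-of-range values of g are replaced by fixed points; they do not arise below.
  fromPartner : (ℕ → ℕ) → Vec (Fin N) N
  fromPartner g = tabulate λ i → clamp (g (toℕ i)) i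

  partner-fromPartner : (g : ℕ → ℕ) → ∀ x → x < N → g x < N → partner (fromPartner g) x ≡ g x
  partner-fromPartner g x x<N gx<N with x <? N
  ... | no x≮N = ⊥-elim (x≮N x<N)
  ... | yes x<N′ rewrite lookup∘tabulate (λ i → clamp (g (toℕ i)) i) (fromℕ< x<N′) | toℕ-fromℕ< x<N′
          with g x <? N
  ...   | yes gx<N′ = toℕ-fromℕ< gx<N′
  ...   | no  gx≮N  = ⊥-elim (gx≮N gx<N)

twistBy : {N : ℕ} → (ℕ → Bool) → Vec (Fin N) N → Vec (Fin N) N
twistBy {N} S v = fromPartner (reverseRuns S N ∘ partner v ∘ reverseRuns S N)

module TwistBy {N : ℕ} (S : ℕ → Bool) (S⊆N : ∀ x → S x ≡ true → x < N)
               (v : Vec (Fin N) N) (m : IsMatching v) where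

  open RunReversal S N S⊆N public

  private
    twisted-< : ∀ x → x < N → φ (partner v (φ x)) < N
    twisted-< x x<N = φ-< _ (partner-< v _ (φ-< x x<N))

  partner-twistBy : ∀ x → x < N → partner (twistBy S v) x ≡ φ (partner v (φ x))
  partner-twistBy x x<N = partner-fromPartner _ x x<N (twisted-< x x<N)

  twistBy-isMatching : IsMatching (twistBy S v)
  twistBy-isMatching x x<N = notFixed , involutive
    where
    v′ = twistBy S v
    φx<N = φ-< x x<N
    notFixed : partner v′ x ≢ x
    notFixed fixed = proj₁ (m (φ x) φx<N) (begin
      partner v (φ x)              ≡⟨ φ-involutive _ ⟨
      φ (φ (partner v (φ x)))      ≡⟨ cong φ (trans (sym (partner-twistBy x x<N)) fixed) ⟩
      φ x                          ∎)
      where open ≡-Reasoning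
    involutive : partner v′ (partner v′ x) ≡ x
    involutive = begin
      partner v′ (partner v′ x)            ≡⟨ cong (partner v′) (partner-twistBy x x<N) ⟩
      partner v′ (φ (partner v (φ x)))     ≡⟨ partner-twistBy _ (twisted-< x x<N) ⟩
      φ (partner v (φ (φ (partner v (φ x))))) ≡⟨ cong (φ ∘ partner v) (φ-involutive _) ⟩
      φ (partner v (partner v (φ x)))      ≡⟨ cong φ (proj₂ (m (φ x) φx<N)) ⟩
      φ (φ x)                              ≡⟨ φ-involutive x ⟩
      x                                    ∎
      where open ≡-Reasoning

  twistBy-involutive : (S′ : ℕ → Bool) → (∀ x → S′ x ≡ S x) → twistBy S′ (twistBy S v) ≡ v
  twistBy-involutive S′ S′≗S = partner-injective λ x x<N → begin
    partner (twistBy S′ v′) x              ≡⟨ partner-fromPartner _ x x<N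
                                                (subst (_< N) (sym (φ′≗φ-twisted x)) (twisted′-< x x<N)) ⟩
    φ′ (partner v′ (φ′ x))                 ≡⟨ φ′≗φ-twisted x ⟩
    φ (partner v′ (φ x))                   ≡⟨ cong φ (partner-twistBy (φ x) (φ-< x x<N)) ⟩
    φ (φ (partner v (φ (φ x))))            ≡⟨ φ-involutive _ ⟩
    partner v (φ (φ x))                    ≡⟨ cong (partner v) (φ-involutive x) ⟩
    partner v x                            ∎
    where
    open ≡-Reasoning
    v′ = twistBy S v
    φ′ = reverseRuns S′ N
    φ′≗φ : ∀ y → φ′ y ≡ φ y
    φ′≗φ = reverseRuns-cong S′≗S N
    φ′≗φ-twisted : ∀ x → φ′ (partner v′ (φ′ x)) ≡ φ (partner v′ (φ x))
    φ′≗φ-twisted x = trans (φ′≗φ _) (cong (φ ∘ partner v′) (φ′≗φ x))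
    twisted′-< : ∀ x → x < N → φ (partner v′ (φ x)) < N
    twisted′-< x x<N = φ-< _ (partner-< v′ _ (φ-< x x<N))

module _ {N : ℕ} where

  isStartᵇ isEndᵇ : Vec (Fin N) N → ℕ → Bool
  isStartᵇ v x = x <ᵇ partner v x
  isEndᵇ   v x = partner v x <ᵇ x

  isStartᵇ⊆N : (v : Vec (Fin N) N) → ∀ x → isStartᵇ v x ≡ true → x < N
  isStartᵇ⊆N v x Sx with x <? N
  ... | yes x<N = x<N
  ... | no  _   = ⊥-elim (<-irrefl refl (<ᵇ-true⁻ {x} {x} Sx))

  isEndᵇ⊆N : (v : Vec (Fin N) N) → ∀ x → isEndᵇ v x ≡ true → x < N
  isEndᵇ⊆N v x Ex with x <? N
  ... | yes x<N = x<N
  ... | no  _   = ⊥-elim (<-irrefl refl (<ᵇ-true⁻ {x} {x} Ex))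

leftTwist rightTwist : {N : ℕ} → Vec (Fin N) N → Vec (Fin N) N
leftTwist  v = twistBy (isStartᵇ v) v
rightTwist v = twistBy (isEndᵇ v) v

module LeftTwist {N : ℕ} (v : Vec (Fin N) N) (m : IsMatching v) where

  open TwistBy (isStartᵇ v) (isStartᵇ⊆N v) v m public

  isStartᵇ-leftTwist : ∀ x → isStartᵇ (leftTwist v) x ≡ isStartᵇ v x
  isStartᵇ-leftTwist x = byRange (x <? N)
    where
    byRange : Dec (x < N) → isStartᵇ (leftTwist v) x ≡ isStartᵇ v x
    byRange (no x≮N) = cong (x <ᵇ_) (trans (partner-out (leftTwist v) x x≮N) (sym (partner-out v x x≮N)))
    byRange (yes x<N) = byCases (isStartᵇ v x) refl
      where
      byCases : ∀ b → isStartᵇ v x ≡ b → isStartᵇ (leftTwist v) x ≡ b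
      byCases true Sx = <ᵇ-true⁺ (subst (x <_) (sym partner′≡y) x<y)
        where
        z = φ x
        Sz = φ-preserves x Sx
        z<N = isStartᵇ⊆N v z Sz
        y = partner v z
        z<y : z < y
        z<y = <ᵇ-true⁻ Sz
        Sy : isStartᵇ v y ≡ false
        Sy = <ᵇ-false⁺ λ y<py → <-asym z<y (subst (y <_) (proj₂ (m z z<N)) y<py)
        x<y : x < y
        x<y = subst (_< y) (φ-involutive x) (φ-<-gap z y Sz Sy z<y)
        partner′≡y : partner (leftTwist v) x ≡ y
        partner′≡y = trans (partner-twistBy x x<N) (φ-fixes y Sy)
      byCases false Sx = <ᵇ-false⁺ (λ x<p′ → <-asym x<p′ (subst (_< x) (sym partner′≡φy) φy<x))
        where
        y = partner v x
        y<x : y < x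
        y<x = ≤∧≢⇒< (≮⇒≥ (<ᵇ-false⁻ Sx)) (proj₁ (m x x<N))
        Sy : isStartᵇ v y ≡ true
        Sy = <ᵇ-true⁺ (subst (y <_) (sym (proj₂ (m x x<N))) y<x)
        φy<x = φ-<-gap y x Sy Sx y<x
        partner′≡φy : partner (leftTwist v) x ≡ φ y
        partner′≡φy = trans (partner-twistBy x x<N) (cong (φ ∘ partner v) (φ-fixes x Sx))

  leftTwist-involutive : leftTwist (leftTwist v) ≡ v
  leftTwist-involutive = twistBy-involutive (isStartᵇ (leftTwist v)) isStartᵇ-leftTwist

module RightTwist {N : ℕ} (v : Vec (Fin N) N) (m : IsMatching v) where

  open TwistBy (isEndᵇ v) (isEndᵇ⊆N v) v m public

  isEndᵇ-rightTwist : ∀ x → isEndᵇ (rightTwist v) x ≡ isEndᵇ v x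
  isEndᵇ-rightTwist x = byRange (x <? N)
    where
    byRange : Dec (x < N) → isEndᵇ (rightTwist v) x ≡ isEndᵇ v x
    byRange (no x≮N) = cong (_<ᵇ x) (trans (partner-out (rightTwist v) x x≮N) (sym (partner-out v x x≮N)))
    byRange (yes x<N) = byCases (isEndᵇ v x) refl
      where
      byCases : ∀ b → isEndᵇ v x ≡ b → isEndᵇ (rightTwist v) x ≡ b
      byCases true Ex = <ᵇ-true⁺ (subst (_< x) (sym partner′≡y) y<x)
        where
        z = φ x
        Ez = φ-preserves x Ex
        z<N = isEndᵇ⊆N v z Ez
        y = partner v z
        y<z : y < z
        y<z = <ᵇ-true⁻ Ez
        Ey : isEndᵇ v y ≡ false
        Ey = <ᵇ-false⁺ λ py<y → <-asym y<z (subst (_< y) (proj₂ (m z z<N)) py<y)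
        y<x : y < x
        y<x = subst (y <_) (φ-involutive x) (gap-<-φ z y Ez Ey y<z)
        partner′≡y : partner (rightTwist v) x ≡ y
        partner′≡y = trans (partner-twistBy x x<N) (φ-fixes y Ey)
      byCases false Ex = <ᵇ-false⁺ (λ p′<x → <-asym p′<x (subst (x <_) (sym partner′≡φy) x<φy))
        where
        y = partner v x
        x<y : x < y
        x<y = ≤∧≢⇒< (≮⇒≥ (<ᵇ-false⁻ {partner v x} {x} Ex)) (proj₁ (m x x<N) ∘ sym)
        Ey : isEndᵇ v y ≡ true
        Ey = <ᵇ-true⁺ (subst (_< y) (sym (proj₂ (m x x<N))) x<y)
        x<φy = gap-<-φ y x Ey Ex x<y
        partner′≡φy : partner (rightTwist v) x ≡ φ y
        partner′≡φy = trans (partner-twistBy x x<N) (cong (φ ∘ partner v) (φ-fixes x Ex))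

  rightTwist-involutive : rightTwist (rightTwist v) ≡ v
  rightTwist-involutive = twistBy-involutive (isEndᵇ (rightTwist v)) isEndᵇ-rightTwist

injective⇒surjective : ∀ {n} (f : Fin n → Fin n) → Injective _≡_ _≡_ f → ∀ k → ∃ λ t → f t ≡ k
injective⇒surjective {suc n} f f-inj k with any? (λ t → f t ≟ᶠ k)
... | yes hit = hit
... | no miss = ⊥-elim (<-irrefl refl (injective⇒≤ g-inj))
  where
  g : Fin (suc n) → Fin n
  g t = punchOut {i = k} {j = f t} (λ k≡ft → miss (t , sym k≡ft))
  g-inj : Injective _≡_ _≡_ g
  g-inj {s} {t} eq =
    f-inj (punchOut-injective {i = k} (λ k≡fs → miss (s , sym k≡fs)) (λ k≡ft → miss (t , sym k≡ft)) eq)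

opposite-+ : ∀ {q} (t : Fin (suc q)) → toℕ (opposite t) + toℕ t ≡ q
opposite-+ {q} t = trans (cong (_+ toℕ t) (opposite-prop t)) (m∸n+n≡m (≤-pred (toℕ<n t)))

record Occurs {p N : ℕ} (π : Fin p → Fin p) (v : Vec (Fin N) N) (i j : ℕ) : Set where
  field
    gap  : i + p ≤ j
    fits : j + p ≤ N
    arcs : ∀ t → partner v (i + toℕ (π t)) ≡ j + toℕ t

  start<end : ∀ t → i + toℕ (π t) < j
  start<end t = <-≤-trans (+-monoʳ-< i (toℕ<n (π t))) gap

  start<N : ∀ t → i + toℕ (π t) < N
  start<N t = <-≤-trans (start<end t) (≤-trans (m≤m+n j p) fits)

  end<N : ∀ t → j + toℕ t < N
  end<N t = <-≤-trans (+-monoʳ-< j (toℕ<n t)) fits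

  i≤N : i ≤ N
  i≤N = ≤-trans (m≤m+n i p) (≤-trans gap (≤-trans (m≤m+n j p) fits))

  j≤N : j ≤ N
  j≤N = ≤-trans (m≤m+n j p) fits

  partner-end : IsMatching v → ∀ t → partner v (j + toℕ t) ≡ i + toℕ (π t)
  partner-end m t = trans (cong (partner v) (sym (arcs t))) (proj₂ (m _ (start<N t)))

module _ {p N : ℕ} (π : Fin p → Fin p) (v : Vec (Fin N) N) {i j : ℕ} where

  T-occursAtᵇ : T (occursAtᵇ π v i j) → Occurs π v i j
  T-occursAtᵇ h with gap , h′ ← to T-∧ h with fits , arcs ← to (T-∧ {j + p ≤ᵇ N}) h′ = record
    { gap  = ≤ᵇ⇒≤ _ _ gap
    ; fits = ≤ᵇ⇒≤ _ _ fits
    ; arcs = λ t → proj₂ (T-isArcᵇ v (T-andL⁻ _ (allFin p) arcs (∈-allFin t)))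
    }

  occursAtᵇ-T : Occurs π v i j → T (occursAtᵇ π v i j)
  occursAtᵇ-T o = from T-∧ (≤⇒≤ᵇ gap , from T-∧ (≤⇒≤ᵇ fits ,
                    T-andL⁺ _ (allFin p) λ {t} _ → isArcᵇ-T v (start<N t) (arcs t)))
    where open Occurs o

occurrences-≡ : ∀ {p N} (π τ : Fin p → Fin p) (v w : Vec (Fin N) N) (f : ℕ × ℕ → ℕ × ℕ)
  → (∀ {i j} → Occurs π v i j → uncurry (Occurs τ w) (f (i , j)))
  → (∀ {i j} → Occurs τ w i j → uncurry (Occurs π v) (f (i , j)))
  → (∀ {i j} → Occurs π v i j → f (f (i , j)) ≡ (i , j))
  → (∀ {i j} → Occurs τ w i j → f (f (i , j)) ≡ (i , j))
  → occurrences π v ≡ occurrences τ w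
occurrences-≡ {N = N} π τ v w f πτ τπ π-inv τ-inv =
  countᵇ-involution _ _ f (grid-Unique N)
    (λ h → let o = T-occursAtᵇ π v h in ∈-grid (Occurs.i≤N o) (Occurs.j≤N o))
    (λ h → let o = T-occursAtᵇ τ w h in ∈-grid (Occurs.i≤N o) (Occurs.j≤N o))
    (λ h → occursAtᵇ-T τ w (πτ (T-occursAtᵇ π v h)))
    (λ h → occursAtᵇ-T π v (τπ (T-occursAtᵇ τ w h)))
    (λ h → π-inv (T-occursAtᵇ π v h))
    (λ h → τ-inv (T-occursAtᵇ τ w h))

private
  cancel-summand : ∀ {x y a b q} → x + a ≡ y + q → b + a ≡ q → x ≡ y + b
  cancel-summand {x} {y} {a} {b} eq refl = +-cancelʳ-≡ a x (y + b) (trans eq (sym (+-assoc y b a)))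

module LeftOccurrence {N : ℕ} (v : Vec (Fin N) N) (m : IsMatching v) {q : ℕ}
       (π τ : Fin (suc q) → Fin (suc q)) (π-injective : Injective _≡_ _≡_ π)
       (τ≗opposite∘π : ∀ t → τ t ≡ opposite (π t)) where

  open LeftTwist v m

  module _ {i j : ℕ} (o : Occurs π v i j) where
    open Occurs o

    starts : ∀ k → k ≤ q → isStartᵇ v (i + k) ≡ true
    starts k k≤q with t , πt≡k ← injective⇒surjective π π-injective (fromℕ< (s≤s k≤q)) =
      subst (λ w → isStartᵇ v (i + w) ≡ true) (trans (cong toℕ πt≡k) (toℕ-fromℕ< (s≤s k≤q)))
        (<ᵇ-true⁺ (subst (i + toℕ (π t) <_) (sym (arcs t)) (≤-trans (start<end t) (m≤m+n j _))))

    non-starts : ∀ t → isStartᵇ v (j + toℕ t) ≡ false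
    non-starts t = <ᵇ-false⁺ λ end<partner → <-asym end<partner
      (subst (_< j + toℕ t) (sym (partner-end m t)) (≤-trans (start<end t) (m≤m+n j _)))

    φ-start : φ (i + q) + q ≡ φ i
    φ-start = trans (sym (φ-+-block starts 0 z≤n)) (trans (+-identityʳ _) (cong φ (+-identityʳ i)))

    partner-leftTwist-end : ∀ t → partner (leftTwist v) (j + toℕ t) ≡ φ (i + q) + toℕ (τ t)
    partner-leftTwist-end t = begin
      partner (leftTwist v) (j + toℕ t)   ≡⟨ partner-twistBy _ (end<N t) ⟩
      φ (partner v (φ (j + toℕ t)))       ≡⟨ cong (φ ∘ partner v) (φ-fixes _ (non-starts t)) ⟩
      φ (partner v (j + toℕ t))           ≡⟨ cong φ (partner-end m t) ⟩
      φ (i + toℕ (π t))                   ≡⟨ cancel-summand (φ-+-block starts _ (≤-pred (toℕ<n (π t)))) τt+πt≡q ⟩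
      φ (i + q) + toℕ (τ t)               ∎
      where
      open ≡-Reasoning
      τt+πt≡q = trans (cong (λ s → toℕ s + toℕ (π t)) (τ≗opposite∘π t)) (opposite-+ (π t))

    occurs-leftTwist : Occurs τ (leftTwist v) (φ (i + q)) j
    occurs-leftTwist = record
      { gap  = subst (_≤ j) (trans (cong suc (sym φ-start)) (sym (+-suc _ q)))
                 (φ-<-gap i j (subst (λ w → isStartᵇ v w ≡ true) (+-identityʳ i) (starts 0 z≤n))
                              (subst (λ w → isStartᵇ v w ≡ false) (+-identityʳ j) (non-starts Fin.zero))
                              (<-≤-trans (m<m+n i z<s) gap))
      ; fits = fits
      ; arcs = λ t → trans (cong (partner (leftTwist v)) (sym (partner-leftTwist-end t)))
                           (proj₂ (twistBy-isMatching _ (end<N t)))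
      }

module RightOccurrence {N : ℕ} (v : Vec (Fin N) N) (m : IsMatching v) {q : ℕ}
       (π τ : Fin (suc q) → Fin (suc q)) (π-injective : Injective _≡_ _≡_ π)
       (τ≗π∘opposite : ∀ t → τ t ≡ π (opposite t)) where

  open RightTwist v m

  module _ {i j : ℕ} (o : Occurs π v i j) where
    open Occurs o

    ends : ∀ k → k ≤ q → isEndᵇ v (j + k) ≡ true
    ends k k≤q = subst (λ w → isEndᵇ v (j + w) ≡ true) (toℕ-fromℕ< (s≤s k≤q))
      (<ᵇ-true⁺ (subst (_< j + toℕ t) (sym (partner-end m t)) (≤-trans (start<end t) (m≤m+n j _))))
      where t = fromℕ< (s≤s k≤q)

    non-ends : ∀ t → isEndᵇ v (i + toℕ (π t)) ≡ false
    non-ends t = <ᵇ-false⁺ λ partner<start → <-asym partner<start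
      (subst (i + toℕ (π t) <_) (sym (arcs t)) (≤-trans (start<end t) (m≤m+n j _)))

    φ-start : φ (j + q) + q ≡ φ j
    φ-start = trans (sym (φ-+-block {j} {q} ends 0 z≤n)) (trans (+-identityʳ _) (cong φ (+-identityʳ j)))

    partner-rightTwist-start : ∀ u → partner (rightTwist v) (i + toℕ (τ u)) ≡ φ (j + q) + toℕ u
    partner-rightTwist-start u = begin
      partner (rightTwist v) (i + toℕ (τ u))    ≡⟨ cong (partner (rightTwist v) ∘ (i +_) ∘ toℕ) (τ≗π∘opposite u) ⟩
      partner (rightTwist v) (i + toℕ (π u′))   ≡⟨ partner-twistBy _ (start<N u′) ⟩
      φ (partner v (φ (i + toℕ (π u′))))        ≡⟨ cong (φ ∘ partner v) (φ-fixes _ (non-ends u′)) ⟩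
      φ (partner v (i + toℕ (π u′)))            ≡⟨ cong φ (arcs u′) ⟩
      φ (j + toℕ u′)                            ≡⟨ cancel-summand (φ-+-block {j} {q} ends _ (≤-pred (toℕ<n u′)))
                                                    (trans (+-comm (toℕ u) (toℕ u′)) (opposite-+ u)) ⟩
      φ (j + q) + toℕ u                         ∎
      where
      open ≡-Reasoning
      u′ = opposite u

    occurs-rightTwist : Occurs τ (rightTwist v) i (φ (j + q))
    occurs-rightTwist = record
      { gap  = subst (_≤ φ (j + q)) (sym (+-suc i q))
                 (gap-<-φ (j + q) (i + q) (ends q ≤-refl)
                          (non-end-last (injective⇒surjective π π-injective (fromℕ q)))
                          (+-monoˡ-< q (<-≤-trans (m<m+n i z<s) gap)))
      ; fits = subst (_≤ N) (trans (cong suc (sym φ-start)) (sym (+-suc _ q)))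
                 (φ-< j (subst (_< N) (+-identityʳ j) (end<N Fin.zero)))
      ; arcs = partner-rightTwist-start
      }
      where
      non-end-last : ∃ (λ t → π t ≡ fromℕ q) → isEndᵇ v (i + q) ≡ false
      non-end-last (t , πt≡q) = subst (λ w → isEndᵇ v (i + w) ≡ false)
                                  (trans (cong toℕ πt≡q) (toℕ-fromℕ q)) (non-ends t)

module _ {N q : ℕ} (v : Vec (Fin N) N) (m : IsMatching v) (π τ : Fin (suc q) → Fin (suc q))
         (π-injective : Injective _≡_ _≡_ π) (τ-injective : Injective _≡_ _≡_ τ) where

  occurrences-leftTwist : (∀ t → τ t ≡ opposite (π t)) → occurrences π v ≡ occurrences τ (leftTwist v)
  occurrences-leftTwist τ≗ = occurrences-≡ π τ v v′ (λ (i , j) → φ (i + q) , j)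
    L.occurs-leftTwist
    (λ {i} {j} o → subst₂ (λ w a → Occurs π w a j) leftTwist-involutive (φ′≗φ (i + q))
                     (L′.occurs-leftTwist o))
    (λ {i} {j} o → cong (_, j) (trans (cong φ (L.φ-start o)) (φ-involutive i)))
    (λ {i} {j} o → cong (_, j) (begin
      φ (φ (i + q) + q)     ≡⟨ cong (λ a → φ (a + q)) (φ′≗φ (i + q)) ⟨
      φ (φ′ (i + q) + q)    ≡⟨ cong φ (L′.φ-start o) ⟩
      φ (φ′ i)              ≡⟨ φ′≗φ (φ′ i) ⟨
      φ′ (φ′ i)             ≡⟨ φ′-involutive i ⟩
      i                     ∎))
    where
    open ≡-Reasoning
    open LeftTwist v m
    v′ = leftTwist v
    π≗ : ∀ t → π t ≡ opposite (τ t)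
    π≗ t = trans (sym (opposite-involutive (π t))) (cong opposite (sym (τ≗ t)))
    module L  = LeftOccurrence v m π τ π-injective τ≗
    module L′ = LeftOccurrence v′ twistBy-isMatching τ π τ-injective π≗
    open LeftTwist v′ twistBy-isMatching using () renaming (φ to φ′; φ-involutive to φ′-involutive)
    φ′≗φ : ∀ x → φ′ x ≡ φ x
    φ′≗φ = reverseRuns-cong isStartᵇ-leftTwist N

  occurrences-rightTwist : (∀ t → τ t ≡ π (opposite t)) → occurrences π v ≡ occurrences τ (rightTwist v)
  occurrences-rightTwist τ≗ = occurrences-≡ π τ v v′ (λ (i , j) → i , φ (j + q))
    R.occurs-rightTwist
    (λ {i} {j} o → subst₂ (λ w a → Occurs π w i a) rightTwist-involutive (φ′≗φ (j + q))
                     (R′.occurs-rightTwist o))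
    (λ {i} {j} o → cong (i ,_) (trans (cong φ (R.φ-start o)) (φ-involutive j)))
    (λ {i} {j} o → cong (i ,_) (begin
      φ (φ (j + q) + q)     ≡⟨ cong (λ a → φ (a + q)) (φ′≗φ (j + q)) ⟨
      φ (φ′ (j + q) + q)    ≡⟨ cong φ (R′.φ-start o) ⟩
      φ (φ′ j)              ≡⟨ φ′≗φ (φ′ j) ⟨
      φ′ (φ′ j)             ≡⟨ φ′-involutive j ⟩
      j                     ∎))
    where
    open ≡-Reasoning
    open RightTwist v m
    v′ = rightTwist v
    π≗ : ∀ t → π t ≡ τ (opposite t)
    π≗ t = trans (cong π (sym (opposite-involutive t))) (sym (τ≗ (opposite t)))
    module R  = RightOccurrence v m π τ π-injective τ≗
    module R′ = RightOccurrence v′ twistBy-isMatching τ π τ-injective π≗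
    open RightTwist v′ twistBy-isMatching using () renaming (φ to φ′; φ-involutive to φ′-involutive)
    φ′≗φ : ∀ x → φ′ x ≡ φ x
    φ′≗φ = reverseRuns-cong isEndᵇ-rightTwist N

module _ {N : ℕ} (twist : Vec (Fin N) N → Vec (Fin N) N)
         (twist-isMatching : ∀ {v} → IsMatching v → IsMatching (twist v))
         (twist-involutive : ∀ {v} → IsMatching v → twist (twist v) ≡ v) where

  countᵇ-matchings-twist : (R R′ : Vec (Fin N) N → Bool)
    → (∀ {v} → IsMatching v → R′ (twist v) ≡ R v) → (∀ {v} → IsMatching v → R (twist v) ≡ R′ v)
    → countᵇ (λ v → isMatchingᵇ v ∧ R v) (allVecs N N)
    ≡ countᵇ (λ v → isMatchingᵇ v ∧ R′ v) (allVecs N N)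
  countᵇ-matchings-twist R R′ R′∘twist R∘twist =
    countᵇ-involution (λ v → isMatchingᵇ v ∧ R v) (λ v → isMatchingᵇ v ∧ R′ v) twist
      (allVecs-Unique N N) (λ _ → ∈-allVecs _) (λ _ → ∈-allVecs _)
      (transfer R R′ R′∘twist) (transfer R′ R R∘twist)
      (λ h → twist-involutive (matching R h)) (λ h → twist-involutive (matching R′ h))
    where
    matching : ∀ R {v} → T (isMatchingᵇ v ∧ R v) → IsMatching v
    matching R {v} h = T-isMatchingᵇ v (proj₁ (to T-∧ h))
    transfer : ∀ R R′ → (∀ {v} → IsMatching v → R′ (twist v) ≡ R v)
      → ∀ {v} → T (isMatchingᵇ v ∧ R v) → T (isMatchingᵇ (twist v) ∧ R′ (twist v))
    transfer R R′ R′∘twist {v} h with hm , hR ← to T-∧ h =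
      from T-∧ (isMatchingᵇ-T _ (twist-isMatching m) , subst T (sym (R′∘twist m)) hR)
      where m = T-isMatchingᵇ v hm

occurrence-counts-symmetric : ∀ {p} (π τ : Fin p → Fin p) (twist : ∀ {N} → Vec (Fin N) N → Vec (Fin N) N)
  → (∀ {N} {v : Vec (Fin N) N} → IsMatching v → IsMatching (twist v))
  → (∀ {N} {v : Vec (Fin N) N} → IsMatching v → twist (twist v) ≡ v)
  → (∀ {N} {v : Vec (Fin N) N} → IsMatching v → occurrences τ v ≡ occurrences π (twist v))
  → (∀ n k m → a₃ π τ n k m ≡ a₃ τ π n k m) × (∀ n k → a₂ π n k ≡ a₂ τ n k)
occurrence-counts-symmetric π τ twist twist-isMatching twist-involutive τ↦π =
  (λ n k m → countᵇ-matchings-twist (twist {2 * n}) twist-isMatching twist-involutive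
               (λ v → (occurrences π v ≡ᵇ k) ∧ (occurrences τ v ≡ᵇ m))
               (λ v → (occurrences τ v ≡ᵇ k) ∧ (occurrences π v ≡ᵇ m))
               (λ mv → cong₂ (λ a b → (a ≡ᵇ k) ∧ (b ≡ᵇ m)) (π↦τ mv) (sym (τ↦π mv)))
               (λ mv → cong₂ (λ a b → (a ≡ᵇ k) ∧ (b ≡ᵇ m)) (sym (τ↦π mv)) (π↦τ mv))) ,
  (λ n k → countᵇ-matchings-twist (twist {2 * n}) twist-isMatching twist-involutive
             (λ v → occurrences π v ≡ᵇ k) (λ v → occurrences τ v ≡ᵇ k)
             (λ mv → cong (_≡ᵇ k) (π↦τ mv))
             (λ mv → cong (_≡ᵇ k) (sym (τ↦π mv))))
  where
  π↦τ : ∀ {N} {v : Vec (Fin N) N} → IsMatching v → occurrences τ (twist v) ≡ occurrences π v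
  π↦τ mv = trans (τ↦π (twist-isMatching mv)) (cong (occurrences π) (twist-involutive mv))

lemma1 : (p : ℕ) → 1 ≤ p → (π τ : Fin p → Fin p)
    → Injective _≡_ _≡_ π → Injective _≡_ _≡_ τ
    → ((∀ t → π t ≡ opposite (τ t)) ⊎ (∀ t → π t ≡ τ (opposite t)))
    → (∀ n k m → a₃ π τ n k m ≡ a₃ τ π n k m) × (∀ n k → a₂ π n k ≡ a₂ τ n k)
lemma1 (suc q) (s≤s z≤n) π τ π-injective τ-injective (inj₁ π≗opposite∘τ) =
  occurrence-counts-symmetric π τ leftTwist
    (λ {_} {v} m → LeftTwist.twistBy-isMatching v m)
    (λ {_} {v} m → LeftTwist.leftTwist-involutive v m)
    (λ {_} {v} m → occurrences-leftTwist v m τ π τ-injective π-injective π≗opposite∘τ)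
lemma1 (suc q) (s≤s z≤n) π τ π-injective τ-injective (inj₂ π≗τ∘opposite) =
  occurrence-counts-symmetric π τ rightTwist
    (λ {_} {v} m → RightTwist.twistBy-isMatching v m)
    (λ {_} {v} m → RightTwist.rightTwist-involutive v m)
    (λ {_} {v} m → occurrences-rightTwist v m τ π τ-injective π-injective π≗τ∘opposite)
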